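{- Let $(b_i)_{i\ge0}$ and $(\lambda_i)_{i\ge1}$ be complex numbers with all $\lambda_i\neq0$, and let $P^{(j)}_k(x)$ be the shifted orthogonal polynomials defined in the context. (1) For all integers $j\ge0$, $k\ge2$ and each $c\in\{1,2,\dots,k-1\}$ one has the edge-cutting identity $$P^{(j)}_k(x)=P^{(j)}_c(x)P^{(j+c)}_{k-c}(x)-\lambda_{c+j}P^{(j)}_{c-1}(x)P^{(j+c+1)}_{k-c-1}(x)$$ and the vertex-cutting identity $$P^{(j)}_k(x)=(x-b_{c+j})P^{(j)}_c(x)P^{(j+c+1)}_{k-c-1}(x)-\lambda_{j+c+1}P^{(j)}_c(x)P^{(j+c+2)}_{k-c-2}(x)-\lambda_{c+j}P^{(j)}_{c-1}(x)P^{(j+c+1)}_{k-c-1}(x),$$ with the convention $P^{(i)}_{ -1}(x)=0$. (2) Suppose further that there are complex numbers $b,\lambda$ with $\lambda\neq0$, sets $\mathcal{D}_b,\mathcal{D}_\lambda$ of indices and decorations $\hat b_i,\hat\lambda_i$ such that $b_i=b$ for $i\notin\mathcal{D}_b$, $b_i=b+\hat b_i$ for $i\in\mathcal{D}_b$, $\lambda_i=\lambda$ for $i\notin\mathcal{D}_\lambda$, $\lambda_i=\lambda+\hat\lambda_i$ for $i\in\mathcal{D}_\lambda$. Fix $j$ and $k$; let $|\mathcal{D}_b|$ and $|\mathcal{D}_\lambda|$ denote the number of indices of $\mathcal{D}_b$, respectively $\mathcal{D}_\lambda$, lying strictly between $j-1$ and $j+k$, and let $d=|\mathcal{D}_b|+|\mathcal{D}_\lambda|$.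 Then $$P^{(j)}_k(x)=\sum_{m=1}^{m_{\max}}a_m\prod_{i=1}^{i_{\max}}S_{k_{m,i}}(x)$$ for some integers $1\le m_{\max}\le 2^{|\mathcal{D}_\lambda|}3^{|\mathcal{D}_b|}$ and $1\le i_{\max}\le d+1$, some positive integers $k_{m,i}$, and coefficients $a_m$ (polynomials in $x$ and the weights) which contain all the dependence on the decorations, where $S_k$ are the background Chebyshev polynomials: $S_0(x)=1$, $S_1(x)=x-b$, $S_{k+1}(x)=(x-b)S_k(x)-\lambda S_{k-1}(x)$.
   Context: Shifted orthogonal polynomials: $P^{(j)}_0(x)=1$, $P^{(j)}_1(x)=x-b_j$, and $P^{(j)}_k(x)=(x-b_{k+j-1})P^{(j)}_{k-1}(x)-\lambda_{k+j-1}P^{(j)}_{k-2}(x)$ for $k\ge2$. The $S_k$ depend only on the background weights $b,\lambda$, not on the decorations $\hat b_i,\hat\lambda_i$. -}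

module Defs where

open import Level using (Level)
open import Algebra.Bundles using (CommutativeRing)
open import Data.Nat using (ℕ; zero; suc; _+_; _≤_; _<_)
open import Data.Bool using (Bool; true; false; if_then_else_)
open import Data.Fin using (Fin)
import Data.Fin as Fin
open import Data.List using (List; []; _∷_)
open import Relation.Binary.PropositionalEquality using (_≡_)

countIn : (ℕ → Bool) → ℕ → ℕ → ℕ
countIn D j zero = 0
countIn D j (suc k) = (if D j then 1 else 0) + countIn D (suc j) k

-- Atomic "cut coefficients": λ_i, or (x - b_i).
data Atom : Set where
  lamA : ℕ → Atom
  xbA  : ℕ → Atom

data Admissible (Db : ℕ → Bool) (j k : ℕ) : Atom → Set where
  lamOk : ∀ {i} → j ≤ i → i < j + k → Admissible Db j k (lamA i)
  xbOk  : ∀ {i} → Db i ≡ true → j ≤ i → i < j + k → Admissible Db j k (xbA i)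

module Poly {c ℓ : Level} (R : CommutativeRing c ℓ) where
  open CommutativeRing R public renaming (_+_ to _+ᴿ_; _*_ to _*ᴿ_; _-_ to _-ᴿ_; -_ to -ᴿ_)

  P : (b lam : ℕ → Carrier) (x : Carrier) → ℕ → ℕ → Carrier
  P b lam x j zero = 1#
  P b lam x j (suc zero) = x -ᴿ b j
  P b lam x j (suc (suc k)) =
    (x -ᴿ b (suc k + j)) *ᴿ P b lam x j (suc k) -ᴿ lam (suc k + j) *ᴿ P b lam x j k

  -- P with the convention P^{(j)}_{-1} = 0 : Pm b lam x j n = P^{(j)}_{n-1}.
  Pm : (b lam : ℕ → Carrier) (x : Carrier) → ℕ → ℕ → Carrier
  Pm b lam x j zero = 0#
  Pm b lam x j (suc n) = P b lam x j n

  S : (b0 λ0 : Carrier) (x : Carrier) → ℕ → Carrier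
  S b0 λ0 x zero = 1#
  S b0 λ0 x (suc zero) = x -ᴿ b0
  S b0 λ0 x (suc (suc k)) = (x -ᴿ b0) *ᴿ S b0 λ0 x (suc k) -ᴿ λ0 *ᴿ S b0 λ0 x k

  sumF : (n : ℕ) → (Fin n → Carrier) → Carrier
  sumF zero f = 0#
  sumF (suc n) f = f Fin.zero +ᴿ sumF n (\ i → f (Fin.suc i))

  prodF : (n : ℕ) → (Fin n → Carrier) → Carrier
  prodF zero f = 1#
  prodF (suc n) f = f Fin.zero *ᴿ prodF n (\ i → f (Fin.suc i))

  atomVal : (b lam : ℕ → Carrier) (x : Carrier) → Atom → Carrier
  atomVal b lam x (lamA i) = lam i
  atomVal b lam x (xbA i) = x -ᴿ b i

  coefVal : (b lam : ℕ → Carrier) (x : Carrier) → Bool → List Atom → Carrier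
  coefVal b lam x s as = (if s then -ᴿ 1# else 1#) *ᴿ go as
    where
    go : List Atom → Carrier
    go [] = 1#
    go (a ∷ as) = atomVal b lam x a *ᴿ go as

-- For fixed j and c the sequences r ↦ P^{(j)}_{c+r}, r ↦ P^{(c+j)}_r and r ↦ P^{(c+j+1)}_{r-1}
-- satisfy one and the same three-term recurrence in r, hence so does any combination of the last
-- two; the edge-cutting identity therefore only has to be checked for r = 0 and r = 1.  The
-- vertex-cutting identity is the edge-cutting one with the left recurrence applied to P^{(c+j)}.
--
-- For the decomposition, cut P^{(j)}_k at its first decorated weight.  All weights before it are
-- background ones, so the left factor is S_c.  A decorated b_i is removed by a vertex cut (three
-- terms), a decorated λ_i by an edge cut (two terms); every term gains one factor S and a
-- coefficient ±(x - b_i) or ±λ_i, and the right factors have one decoration fewer.  Induction on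
-- k gives at most 2^{|D_λ|} 3^{|D_b|} terms with at most d + 1 factors each.
module Submission where

open import Level using (Level)
open import Algebra.Bundles using (CommutativeRing)
import Algebra.Properties.Ring as RingProperties
import Algebra.Properties.Group as GroupProperties
import Algebra.Properties.AbelianGroup as AbelianGroupProperties
import Algebra.Properties.CommutativeSemigroup as CommutativeSemigroupProperties
open import Data.Bool using (Bool; true; false; not; _xor_)
open import Data.Fin as Fin using (Fin)
open import Data.List using (List; []; _∷_; _++_; map; length; lookup)
open import Data.List.Properties using (length-map; length-++)
open import Data.List.Relation.Unary.All as All using (All; []; _∷_)
open import Data.List.Relation.Unary.All.Properties using (++⁺; gmap⁺)
open import Data.List.Membership.Propositional.Properties using (∈-lookup)
open import Data.Nat using (ℕ; zero; suc; pred; _+_; _∸_; _*_; _^_; _≤_; _<_; s≤s; z≤n)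
import Data.Nat.Properties as ℕ
open import Data.Nat.Induction using (<-rec)
open import Data.Nat.Tactic.RingSolver using (solve-∀)
open import Data.Product using (_×_; _,_; proj₁; proj₂; uncurry; Σ; ∃-syntax)
open import Relation.Nullary using (¬_)
import Relation.Binary.PropositionalEquality as ≡
open ≡ using (_≡_)
open import Defs

shift-index : ∀ c n i → suc (c + n) + i ≡ suc n + (c + i)
shift-index = solve-∀

module Cutting {c ℓ : Level} (R : CommutativeRing c ℓ) where
  open Poly R hiding (zero)
  open RingProperties ring using (x[y-z]≈xy-xz; -0#≈0#)
  open GroupProperties +-group using () renaming (//-cong₂ to -‿cong₂)
  open AbelianGroupProperties +-abelianGroup using (⁻¹-∙-comm)
  open CommutativeSemigroupProperties +-commutativeSemigroup using (interchange)
  open CommutativeSemigroupProperties *-commutativeSemigroup using (x∙yz≈y∙xz)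
  open import Relation.Binary.Reasoning.Setoid setoid

  *1-minus-0 : ∀ p {w} → w ≈ 0# → p *ᴿ 1# -ᴿ w ≈ p
  *1-minus-0 p {w} w≈0 = begin
    p *ᴿ 1# -ᴿ w  ≈⟨ -‿cong₂ (*-identityʳ p) w≈0 ⟩
    p -ᴿ 0#       ≈⟨ +-congˡ -0#≈0# ⟩
    p +ᴿ 0#       ≈⟨ +-identityʳ p ⟩
    p             ∎

  minus-interchange : ∀ p q r s → (p -ᴿ q) -ᴿ (r -ᴿ s) ≈ (p -ᴿ r) -ᴿ (q -ᴿ s)
  minus-interchange p q r s = begin
    (p -ᴿ q) -ᴿ (r -ᴿ s)            ≈⟨ +-congˡ (sym (⁻¹-∙-comm r (-ᴿ s))) ⟩
    (p -ᴿ q) +ᴿ (-ᴿ r +ᴿ -ᴿ (-ᴿ s)) ≈⟨ interchange p (-ᴿ q) (-ᴿ r) (-ᴿ (-ᴿ s)) ⟩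
    (p -ᴿ r) +ᴿ (-ᴿ q +ᴿ -ᴿ (-ᴿ s)) ≈⟨ +-congˡ (⁻¹-∙-comm q (-ᴿ s)) ⟩
    (p -ᴿ r) -ᴿ (q -ᴿ s)            ∎

  recurrence-linear : ∀ X L A B l u₁ u₀ v₁ v₀ →
    X *ᴿ (A *ᴿ u₁ -ᴿ l *ᴿ (B *ᴿ v₁)) -ᴿ L *ᴿ (A *ᴿ u₀ -ᴿ l *ᴿ (B *ᴿ v₀))
    ≈ A *ᴿ (X *ᴿ u₁ -ᴿ L *ᴿ u₀) -ᴿ l *ᴿ (B *ᴿ (X *ᴿ v₁ -ᴿ L *ᴿ v₀))
  recurrence-linear X L A B l u₁ u₀ v₁ v₀ = begin
    X *ᴿ (A *ᴿ u₁ -ᴿ l *ᴿ (B *ᴿ v₁)) -ᴿ L *ᴿ (A *ᴿ u₀ -ᴿ l *ᴿ (B *ᴿ v₀))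
      ≈⟨ -‿cong₂ (x[y-z]≈xy-xz X _ _) (x[y-z]≈xy-xz L _ _) ⟩
    (X *ᴿ (A *ᴿ u₁) -ᴿ X *ᴿ (l *ᴿ (B *ᴿ v₁))) -ᴿ (L *ᴿ (A *ᴿ u₀) -ᴿ L *ᴿ (l *ᴿ (B *ᴿ v₀)))
      ≈⟨ minus-interchange _ _ _ _ ⟩
    (X *ᴿ (A *ᴿ u₁) -ᴿ L *ᴿ (A *ᴿ u₀)) -ᴿ (X *ᴿ (l *ᴿ (B *ᴿ v₁)) -ᴿ L *ᴿ (l *ᴿ (B *ᴿ v₀)))
      ≈⟨ -‿cong₂ (-‿cong₂ (x∙yz≈y∙xz X A u₁) (x∙yz≈y∙xz L A u₀))
                 (-‿cong₂ (swap₃ X l B v₁) (swap₃ L l B v₀)) ⟩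
    (A *ᴿ (X *ᴿ u₁) -ᴿ A *ᴿ (L *ᴿ u₀)) -ᴿ (l *ᴿ (B *ᴿ (X *ᴿ v₁)) -ᴿ l *ᴿ (B *ᴿ (L *ᴿ v₀)))
      ≈⟨ -‿cong₂ (sym (x[y-z]≈xy-xz A _ _))
                 (trans (sym (x[y-z]≈xy-xz l _ _)) (*-congˡ (sym (x[y-z]≈xy-xz B _ _)))) ⟩
    A *ᴿ (X *ᴿ u₁ -ᴿ L *ᴿ u₀) -ᴿ l *ᴿ (B *ᴿ (X *ᴿ v₁ -ᴿ L *ᴿ v₀)) ∎
    where
    swap₃ : ∀ p q r s → p *ᴿ (q *ᴿ (r *ᴿ s)) ≈ q *ᴿ (r *ᴿ (p *ᴿ s))
    swap₃ p q r s = trans (x∙yz≈y∙xz p q _) (*-congˡ (x∙yz≈y∙xz p r s))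

  module Recurrence (b lam : ℕ → Carrier) (x : Carrier) where

    P′ Pm′ : ℕ → ℕ → Carrier
    P′ = P b lam x
    Pm′ = Pm b lam x

    Solves : ℕ → (ℕ → Carrier) → Set ℓ
    Solves i u = ∀ n → u (suc (suc n)) ≈ (x -ᴿ b (suc n + i)) *ᴿ u (suc n) -ᴿ lam (suc n + i) *ᴿ u n

    solutions-unique : ∀ {i u v} → Solves i u → Solves i v → u 0 ≈ v 0 → u 1 ≈ v 1 → ∀ n → u n ≈ v n
    solutions-unique su sv e₀ e₁ zero = e₀
    solutions-unique su sv e₀ e₁ (suc zero) = e₁
    solutions-unique su sv e₀ e₁ (suc (suc n)) = begin
      _ ≈⟨ su n ⟩
      _ ≈⟨ -‿cong₂ (*-congˡ (solutions-unique su sv e₀ e₁ (suc n)))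
                   (*-congˡ (solutions-unique su sv e₀ e₁ n)) ⟩
      _ ≈⟨ sv n ⟨
      _ ∎

    combination-solves : ∀ {i u v} A l B → Solves i u → Solves i v →
      Solves i (λ n → A *ᴿ u n -ᴿ l *ᴿ (B *ᴿ v n))
    combination-solves A l B su sv n =
      trans (-‿cong₂ (*-congˡ (su n)) (*-congˡ (*-congˡ (sv n)))) (sym (recurrence-linear _ _ A B l _ _ _ _))

    Solves-shift : ∀ {i u} c → Solves i u → Solves (c + i) (λ n → u (c + n))
    Solves-shift {i} {u} c su n = begin
      u (c + suc (suc n))
        ≡⟨ ≡.cong u (+-suc² c n) ⟩
      u (suc (suc (c + n)))
        ≈⟨ su (c + n) ⟩
      (x -ᴿ b (suc (c + n) + i)) *ᴿ u (suc (c + n)) -ᴿ lam (suc (c + n) + i) *ᴿ u (c + n)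
        ≡⟨ ≡.cong₂ (λ m k → (x -ᴿ b m) *ᴿ u k -ᴿ lam m *ᴿ u (c + n))
                   (shift-index c n i) (≡.sym (ℕ.+-suc c n)) ⟩
      (x -ᴿ b (suc n + (c + i))) *ᴿ u (c + suc n) -ᴿ lam (suc n + (c + i)) *ᴿ u (c + n) ∎
      where
      +-suc² : ∀ c n → c + suc (suc n) ≡ suc (suc (c + n))
      +-suc² c n = ≡.trans (ℕ.+-suc c (suc n)) (≡.cong suc (ℕ.+-suc c n))

    P-suc : ∀ i n → P′ i (suc n) ≈ (x -ᴿ b (n + i)) *ᴿ P′ i n -ᴿ lam (n + i) *ᴿ Pm′ i n
    P-suc i zero = sym (*1-minus-0 _ (zeroʳ _))
    P-suc i (suc n) = refl

    P-solves : ∀ i → Solves i (P′ i)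
    P-solves i n = refl

    Pm-solves : ∀ i → Solves i (Pm′ (suc i))
    Pm-solves i n =
      ≡.subst (λ m → P′ (suc i) (suc n) ≈ (x -ᴿ b m) *ᴿ P′ (suc i) n -ᴿ lam m *ᴿ Pm′ (suc i) n)
              (ℕ.+-suc n i) (P-suc (suc i) n)

    P-cut : ∀ j c r → P′ j (c + r)
      ≈ P′ j c *ᴿ P′ (c + j) r -ᴿ lam (c + j) *ᴿ (Pm′ j c *ᴿ Pm′ (suc (c + j)) r)
    P-cut j c = solutions-unique
      (Solves-shift c (P-solves j))
      (combination-solves _ _ _ (P-solves (c + j)) (Pm-solves (c + j)))
      at-0 at-1
      where
      at-0 : P′ j (c + 0) ≈ P′ j c *ᴿ 1# -ᴿ lam (c + j) *ᴿ (Pm′ j c *ᴿ 0#)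
      at-0 = begin
        P′ j (c + 0) ≡⟨ ≡.cong (P′ j) (ℕ.+-identityʳ c) ⟩
        P′ j c       ≈⟨ *1-minus-0 _ (trans (*-congˡ (zeroʳ _)) (zeroʳ _)) ⟨
        P′ j c *ᴿ 1# -ᴿ lam (c + j) *ᴿ (Pm′ j c *ᴿ 0#) ∎
      at-1 : P′ j (c + 1) ≈ P′ j c *ᴿ (x -ᴿ b (c + j)) -ᴿ lam (c + j) *ᴿ (Pm′ j c *ᴿ 1#)
      at-1 = begin
        P′ j (c + 1) ≡⟨ ≡.cong (P′ j) (ℕ.+-comm c 1) ⟩
        P′ j (suc c) ≈⟨ P-suc j c ⟩
        (x -ᴿ b (c + j)) *ᴿ P′ j c -ᴿ lam (c + j) *ᴿ Pm′ j c
          ≈⟨ -‿cong₂ (*-comm _ _) (*-congˡ (*-identityʳ _)) ⟨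
        P′ j c *ᴿ (x -ᴿ b (c + j)) -ᴿ lam (c + j) *ᴿ (Pm′ j c *ᴿ 1#) ∎

    P-vertex-cut : ∀ j c r → P′ j (c + suc r)
      ≈ (x -ᴿ b (c + j)) *ᴿ (P′ j c *ᴿ P′ (suc (c + j)) r)
        -ᴿ lam (suc (c + j)) *ᴿ (P′ j c *ᴿ Pm′ (suc (suc (c + j))) r)
        -ᴿ lam (c + j) *ᴿ (Pm′ j c *ᴿ P′ (suc (c + j)) r)
    P-vertex-cut j c r = begin
      P′ j (c + suc r)
        ≈⟨ P-cut j c (suc r) ⟩
      A *ᴿ P′ (c + j) (suc r) -ᴿ lam (c + j) *ᴿ (B *ᴿ Q₁)
        ≈⟨ -‿cong₂ (*-congˡ (P-cut (c + j) 1 r)) refl ⟩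
      A *ᴿ (X *ᴿ Q₁ -ᴿ l *ᴿ (1# *ᴿ Q₂)) -ᴿ lam (c + j) *ᴿ (B *ᴿ Q₁)
        ≈⟨ -‿cong₂ (x[y-z]≈xy-xz A _ _) refl ⟩
      (A *ᴿ (X *ᴿ Q₁) -ᴿ A *ᴿ (l *ᴿ (1# *ᴿ Q₂))) -ᴿ lam (c + j) *ᴿ (B *ᴿ Q₁)
        ≈⟨ -‿cong₂ (-‿cong₂ (x∙yz≈y∙xz A X Q₁)
                            (trans (*-congˡ (*-congˡ (*-identityˡ Q₂))) (x∙yz≈y∙xz A l Q₂))) refl ⟩
      X *ᴿ (A *ᴿ Q₁) -ᴿ l *ᴿ (A *ᴿ Q₂) -ᴿ lam (c + j) *ᴿ (B *ᴿ Q₁) ∎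
      where
      A = P′ j c
      B = Pm′ j c
      X = x -ᴿ b (c + j)
      l = lam (suc (c + j))
      Q₁ = P′ (suc (c + j)) r
      Q₂ = Pm′ (suc (suc (c + j))) r

    cut-identities : ∀ j k c → 2 ≤ k → 1 ≤ c → c ≤ k ∸ 1 →
      (P′ j k ≈ P′ j c *ᴿ P′ (j + c) (k ∸ c)
          -ᴿ lam (c + j) *ᴿ (P′ j (c ∸ 1) *ᴿ P′ (j + c + 1) (k ∸ c ∸ 1)))
      × (P′ j k ≈ (x -ᴿ b (c + j)) *ᴿ (P′ j c *ᴿ P′ (j + c + 1) (k ∸ c ∸ 1))
          -ᴿ lam (j + c + 1) *ᴿ (P′ j c *ᴿ Pm′ (j + c + 2) (k ∸ c ∸ 1))
          -ᴿ lam (c + j) *ᴿ (P′ j (c ∸ 1) *ᴿ P′ (j + c + 1) (k ∸ c ∸ 1)))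
    cut-identities j (suc k) (suc c) _ (s≤s z≤n) c<k with ℕ.m≤n⇒∃[o]m+o≡n c<k
    ... | r , e with ≡.trans (ℕ.+-suc c r) e
    ... | ≡.refl
      rewrite ℕ.m+n∸m≡n c (suc r) | ℕ.+-comm j (suc c) | ℕ.+-comm (suc (c + j)) 1 | ℕ.+-comm (suc (c + j)) 2
      = P-cut j (suc c) (suc r) , P-vertex-cut j (suc c) r

-- Decorated λ's among λ_{j+1}, …, λ_{j+k-1}; λ_j does not occur in P^{(j)}_k.
interior : (ℕ → Bool) → ℕ → ℕ → ℕ
interior D j k = countIn D (suc j) (pred k)

interior≤countIn : ∀ D j k → interior D j k ≤ countIn D j k
interior≤countIn D j zero = z≤n
interior≤countIn D j (suc k) = ℕ.m≤n+m _ _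

countIn-suffix : ∀ D d j {m k} → d + m ≡ k → countIn D (d + j) m ≤ countIn D j k
countIn-suffix D zero j ≡.refl = ℕ.≤-refl
countIn-suffix D (suc d) j {m} ≡.refl = begin
  countIn D (suc d + j) m   ≡⟨ ≡.cong (λ i → countIn D i m) (ℕ.+-suc d j) ⟨
  countIn D (d + suc j) m   ≤⟨ countIn-suffix D d (suc j) ≡.refl ⟩
  countIn D (suc j) (d + m) ≤⟨ ℕ.m≤n+m _ _ ⟩
  countIn D j (suc d + m)   ∎
  where open ℕ.≤-Reasoning

interior-suffix : ∀ D d j {m k} → d + m ≡ k → interior D (d + j) m ≤ interior D j k
interior-suffix D zero j ≡.refl = ℕ.≤-refl
interior-suffix D (suc d) j {m} ≡.refl = begin
  interior D (suc d + j) m   ≡⟨ ≡.cong (λ i → interior D i m) (ℕ.+-suc d j) ⟨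
  interior D (d + suc j) m   ≤⟨ interior-suffix D d (suc j) ≡.refl ⟩
  interior D (suc j) (d + m) ≤⟨ interior≤countIn D (suc j) (d + m) ⟩
  interior D j (suc d + m)   ∎
  where open ℕ.≤-Reasoning

countIn-decorated : ∀ D d j m → D (d + j) ≡ true → suc (countIn D (suc d + j) m) ≤ countIn D j (d + suc m)
countIn-decorated D d j m e = ≡.subst (_≤ countIn D j (d + suc m)) head (countIn-suffix D d j ≡.refl)
  where
  head : countIn D (d + j) (suc m) ≡ suc (countIn D (suc d + j) m)
  head rewrite e = ≡.refl

interior-decorated : ∀ D d j m → D (suc d + j) ≡ true →
  suc (interior D (suc d + j) (suc m)) ≤ interior D j (suc d + suc m)
interior-decorated D d j m e =
  ≡.subst (λ i → suc (countIn D (suc i) m) ≤ countIn D (suc j) (d + suc m)) (ℕ.+-suc d j)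
    (countIn-decorated D d (suc j) m (≡.subst (λ i → D i ≡ true) (≡.sym (ℕ.+-suc d j)) e))

window-end : ∀ d j k → d + j + k ≡ j + (d + k)
window-end = solve-∀

shorter : ∀ {d k′ k} → suc d + k′ ≡ k → k′ < k
shorter {d} {k′} e = ≡.subst (k′ <_) e (s≤s (ℕ.m≤n+m k′ d))

offset<end : ∀ {d k′ k} j → suc d + k′ ≡ k → d + j < j + k
offset<end {d} {k′} j e =
  ℕ.≤-trans (ℕ.m≤m+n (suc (d + j)) k′) (ℕ.≤-reflexive (≡.trans (window-end (suc d) j k′) (≡.cong (j +_) e)))

within-suffix : ∀ {d j k′ k i} → d + k′ ≡ k → d + j ≤ i → i < d + j + k′ → j ≤ i × i < j + k
within-suffix {d} {j} {k′} e start≤i i<end =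
  ℕ.≤-trans (ℕ.m≤n+m j d) start≤i ,
  ℕ.<-≤-trans i<end (ℕ.≤-reflexive (≡.trans (window-end d j k′) (≡.cong (j +_) e)))

Admissible-suffix : ∀ {Db d j k′ k a} → d + k′ ≡ k → Admissible Db (d + j) k′ a → Admissible Db j k a
Admissible-suffix e (lamOk start≤i i<end) = uncurry lamOk (within-suffix e start≤i i<end)
Admissible-suffix e (xbOk db start≤i i<end) = uncurry (xbOk db) (within-suffix e start≤i i<end)

module Decorations (Db Dlam : ℕ → Bool) where

  -- None of the weights b_j, …, b_{j+c-1}, λ_{j+1}, …, λ_{j+c-1} of P^{(j)}_c is decorated.
  data Undecorated (j : ℕ) : ℕ → Set where
    []     : Undecorated j 0
    first  : Db j ≡ false → Undecorated j 1
    extend : ∀ {c} → Undecorated j (suc c) → Db (suc c + j) ≡ false → Dlam (suc c + j) ≡ false →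
             Undecorated j (suc (suc c))

  data FirstDecoration (j : ℕ) : ℕ → Set where
    none : ∀ {k} → Undecorated j k → FirstDecoration j k
    at-b : ∀ c r → Undecorated j c → Db (c + j) ≡ true → FirstDecoration j (c + suc r)
    at-λ : ∀ c r → Undecorated j (suc c) → Dlam (suc c + j) ≡ true → FirstDecoration j (suc c + suc r)

  firstDecoration : ∀ j k → FirstDecoration j k
  firstDecoration j k = scan 0 k []
    where
    scan : ∀ c r → Undecorated j c → FirstDecoration j (c + r)
    scan c zero u = none (≡.subst (Undecorated j) (≡.sym (ℕ.+-identityʳ c)) u)
    scan c (suc r) u with Db (c + j) in db
    ... | true = at-b c r u db
    scan zero (suc r) u | false = scan 1 r (first db)
    scan (suc c) (suc r) u | false with Dlam (suc c + j) in dl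
    ... | true = at-λ c r u dl
    ... | false = ≡.subst (FirstDecoration j) (≡.sym (ℕ.+-suc (suc c) r))
                          (scan (suc (suc c)) r (extend u db dl))

twice : ∀ p q → p * q + p * q ≡ 2 * p * q
twice = solve-∀

thrice : ∀ p q → p * q + (p * q + p * q) ≡ p * (3 * q)
thrice = solve-∀

suc-inside : ∀ m n → suc (m + n + 1) ≡ m + suc n + 1
suc-inside = solve-∀

module Decomposition {c ℓ : Level} (R : CommutativeRing c ℓ) where
  open Poly R hiding (zero)
  open Cutting R using (module Recurrence)
  open RingProperties ring using (-‿distribˡ-*; -‿involutive; -1*x≈-x)
  open GroupProperties +-group using () renaming (//-cong₂ to -‿cong₂)
  open CommutativeSemigroupProperties *-commutativeSemigroup using (x∙yz≈y∙xz)
  open import Relation.Binary.Reasoning.Setoid setoid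

  module _ (b lam : ℕ → Carrier) (b₀ lam₀ : Carrier) (Db Dlam : ℕ → Bool) (x : Carrier)
           (b-background : ∀ i → Db i ≡ false → b i ≈ b₀)
           (lam-background : ∀ i → 1 ≤ i → Dlam i ≡ false → lam i ≈ lam₀) where

    open Recurrence b lam x
    open Decorations Db Dlam

    S′ : ℕ → Carrier
    S′ = S b₀ lam₀ x

    Sm : ℕ → Carrier
    Sm zero = 0#
    Sm (suc n) = S′ n

    P-undecorated : ∀ {j c} → Undecorated j c → Pm′ j c ≈ Sm c × P′ j c ≈ S′ c
    P-undecorated [] = refl , refl
    P-undecorated (first db) = refl , -‿cong₂ refl (b-background _ db)
    P-undecorated (extend u db dl) with P-undecorated u
    ... | Pm≈ , P≈ = P≈ , -‿cong₂ (*-cong (-‿cong₂ refl (b-background _ db)) P≈)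
                                  (*-cong (lam-background _ (s≤s z≤n) dl) Pm≈)

    record Term : Set where
      constructor term
      field
        negative : Bool
        atoms    : List Atom
        factors  : List ℕ
    open Term

    ∏S : List ℕ → Carrier
    ∏S [] = 1#
    ∏S (k ∷ ks) = S′ k *ᴿ ∏S ks

    ⟦_⟧ : Term → Carrier
    ⟦ t ⟧ = coefVal b lam x (negative t) (atoms t) *ᴿ ∏S (factors t)

    sumTerms : List Term → Carrier
    sumTerms [] = 0#
    sumTerms (t ∷ ts) = ⟦ t ⟧ +ᴿ sumTerms ts

    sumTerms-++ : ∀ ts us → sumTerms (ts ++ us) ≈ sumTerms ts +ᴿ sumTerms us
    sumTerms-++ [] us = sym (+-identityˡ _)
    sumTerms-++ (t ∷ ts) us = trans (+-congˡ (sumTerms-++ ts us)) (sym (+-assoc _ _ _))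

    coefVal-∷ : ∀ s a as → coefVal b lam x s (a ∷ as) ≈ atomVal b lam x a *ᴿ coefVal b lam x s as
    coefVal-∷ s a as = x∙yz≈y∙xz _ _ _

    coefVal-not : ∀ s as → coefVal b lam x (not s) as ≈ -ᴿ coefVal b lam x s as
    coefVal-not false as = trans (-1*x≈-x _) (-‿cong (sym (*-identityˡ _)))
    coefVal-not true as = sym (trans (-‿cong (-1*x≈-x _)) (trans (-‿involutive _) (sym (*-identityˡ _))))

    data Prefix : Set where
      unit       : Prefix
      plus minus : Atom → Prefix

    prefixValue : Prefix → Carrier
    prefixValue unit = 1#
    prefixValue (plus a) = atomVal b lam x a
    prefixValue (minus a) = -ᴿ atomVal b lam x a

    prefixAtoms : Prefix → List Atom
    prefixAtoms unit = []
    prefixAtoms (plus a) = a ∷ []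
    prefixAtoms (minus a) = a ∷ []

    flipsSign : Prefix → Bool
    flipsSign (minus a) = true
    flipsSign _ = false

    attach : Prefix → ℕ → Term → Term
    attach p n t = term (flipsSign p xor negative t) (prefixAtoms p ++ atoms t) (n ∷ factors t)

    attach-value : ∀ p n t → ⟦ attach p n t ⟧ ≈ prefixValue p *ᴿ (S′ n *ᴿ ⟦ t ⟧)
    attach-value unit n t = trans (x∙yz≈y∙xz _ _ _) (sym (*-identityˡ _))
    attach-value (plus a) n (term s as ns) = trans (*-congʳ (coefVal-∷ s a as)) (regroup _ _ _ _)
      where
      regroup : ∀ α γ σ π → (α *ᴿ γ) *ᴿ (σ *ᴿ π) ≈ α *ᴿ (σ *ᴿ (γ *ᴿ π))
      regroup α γ σ π = trans (*-assoc α γ _) (*-congˡ (x∙yz≈y∙xz γ σ π))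
    attach-value (minus a) n (term s as ns) = begin
      coefVal b lam x (not s) (a ∷ as) *ᴿ (S′ n *ᴿ ∏S ns)
        ≈⟨ *-congʳ (coefVal-not s (a ∷ as)) ⟩
      (-ᴿ coefVal b lam x s (a ∷ as)) *ᴿ (S′ n *ᴿ ∏S ns)
        ≈⟨ -‿distribˡ-* _ _ ⟨
      -ᴿ (coefVal b lam x s (a ∷ as) *ᴿ (S′ n *ᴿ ∏S ns))
        ≈⟨ -‿cong (attach-value (plus a) n (term s as ns)) ⟩
      -ᴿ (atomVal b lam x a *ᴿ (S′ n *ᴿ ⟦ term s as ns ⟧))
        ≈⟨ -‿distribˡ-* _ _ ⟩
      (-ᴿ atomVal b lam x a) *ᴿ (S′ n *ᴿ ⟦ term s as ns ⟧) ∎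

    sumTerms-attach : ∀ p n ts → sumTerms (map (attach p n) ts) ≈ prefixValue p *ᴿ (S′ n *ᴿ sumTerms ts)
    sumTerms-attach p n [] = sym (trans (*-congˡ (zeroʳ _)) (zeroʳ _))
    sumTerms-attach p n (t ∷ ts) = begin
      ⟦ attach p n t ⟧ +ᴿ sumTerms (map (attach p n) ts)
        ≈⟨ +-cong (attach-value p n t) (sumTerms-attach p n ts) ⟩
      prefixValue p *ᴿ (S′ n *ᴿ ⟦ t ⟧) +ᴿ prefixValue p *ᴿ (S′ n *ᴿ sumTerms ts)
        ≈⟨ trans (*-congˡ (distribˡ _ _ _)) (distribˡ _ _ _) ⟨
      prefixValue p *ᴿ (S′ n *ᴿ (⟦ t ⟧ +ᴿ sumTerms ts)) ∎

    record Expansion (j k L M F : ℕ) (v : Carrier) : Set ℓ where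
      field
        terms      : List Term
        #terms≥    : L ≤ length terms
        #terms≤    : length terms ≤ M
        #factors≤  : All (λ t → length (factors t) ≤ F) terms
        admissible : All (λ t → All (Admissible Db j k) (atoms t)) terms
        value      : v ≈ sumTerms terms
    open Expansion

    empty : ∀ {j k M F v} → v ≈ 0# → Expansion j k 0 M F v
    empty v≈0 = record
      { terms = [] ; #terms≥ = z≤n ; #terms≤ = z≤n ; #factors≤ = [] ; admissible = [] ; value = v≈0 }

    relax : ∀ {j k L L′ M M′ F F′ v v′} → L′ ≤ L → M ≤ M′ → F ≤ F′ → v′ ≈ v →
      Expansion j k L M F v → Expansion j k L′ M′ F′ v′
    relax L′≤L M≤M′ F≤F′ v′≈v e = record
      { terms = terms e
      ; #terms≥ = ℕ.≤-trans L′≤L (#terms≥ e)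
      ; #terms≤ = ℕ.≤-trans (#terms≤ e) M≤M′
      ; #factors≤ = All.map (λ h → ℕ.≤-trans h F≤F′) (#factors≤ e)
      ; admissible = admissible e
      ; value = trans v′≈v (value e) }

    infixr 5 _∪_
    _∪_ : ∀ {j k L₁ L₂ M₁ M₂ F v₁ v₂} → Expansion j k L₁ M₁ F v₁ → Expansion j k L₂ M₂ F v₂ →
      Expansion j k (L₁ + L₂) (M₁ + M₂) F (v₁ +ᴿ v₂)
    e ∪ f = record
      { terms = terms e ++ terms f
      ; #terms≥ = ℕ.≤-trans (ℕ.+-mono-≤ (#terms≥ e) (#terms≥ f)) (ℕ.≤-reflexive (≡.sym (length-++ (terms e))))
      ; #terms≤ = ℕ.≤-trans (ℕ.≤-reflexive (length-++ (terms e))) (ℕ.+-mono-≤ (#terms≤ e) (#terms≤ f))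
      ; #factors≤ = ++⁺ (#factors≤ e) (#factors≤ f)
      ; admissible = ++⁺ (admissible e) (admissible f)
      ; value = trans (+-cong (value e) (value f)) (sym (sumTerms-++ (terms e) (terms f))) }

    attachᴱ : ∀ {j k d k′ L M F v} (p : Prefix) → All (Admissible Db j k) (prefixAtoms p) → (n : ℕ) →
      d + k′ ≡ k → Expansion (d + j) k′ L M F v → Expansion j k L M (suc F) (prefixValue p *ᴿ (S′ n *ᴿ v))
    attachᴱ p p-admissible n suffix e = record
      { terms = map (attach p n) (terms e)
      ; #terms≥ = ℕ.≤-trans (#terms≥ e) (ℕ.≤-reflexive (≡.sym (length-map (attach p n) (terms e))))
      ; #terms≤ = ℕ.≤-trans (ℕ.≤-reflexive (length-map (attach p n) (terms e))) (#terms≤ e)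
      ; #factors≤ = gmap⁺ s≤s (#factors≤ e)
      ; admissible = gmap⁺ (λ as → ++⁺ p-admissible (All.map (Admissible-suffix suffix) as)) (admissible e)
      ; value = trans (*-congˡ (*-congˡ (value e))) (sym (sumTerms-attach p n (terms e))) }

    prepend-λ : ∀ {j k d k′ L M F v} n → suc d + k′ ≡ k → Expansion (suc d + j) k′ L M F v →
      Expansion j k L M (suc F) ((-ᴿ lam (d + j)) *ᴿ (S′ n *ᴿ v))
    prepend-λ {j} {d = d} n suffix =
      attachᴱ (minus (lamA (d + j))) (lamOk (ℕ.m≤n+m j d) (offset<end j suffix) ∷ []) n suffix

    Expansible : ℕ → Set ℓ
    Expansible k = ∀ j A B → interior Dlam j k ≤ A → countIn Db j k ≤ B →
      Expansion j k 1 (2 ^ A * 3 ^ B) (B + A + 1) (P′ j k)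

    background : ∀ {j k A B} → Undecorated j k → Expansion j k 1 (2 ^ A * 3 ^ B) (B + A + 1) (P′ j k)
    background {j} {k} {A} {B} u = record
      { terms = term false [] (k ∷ []) ∷ []
      ; #terms≥ = ℕ.≤-refl
      ; #terms≤ = ℕ.*-mono-≤ (ℕ.m^n>0 2 A) (ℕ.m^n>0 3 B)
      ; #factors≤ = ℕ.m≤n+m 1 (B + A) ∷ []
      ; admissible = [] ∷ []
      ; value = trans (proj₂ (P-undecorated u)) (sym single-term) }
      where
      single-term : (1# *ᴿ 1#) *ᴿ (S′ k *ᴿ 1#) +ᴿ 0# ≈ S′ k
      single-term = trans (+-identityʳ _)
        (trans (*-congʳ (*-identityˡ 1#)) (trans (*-identityˡ _) (*-identityʳ _)))

    vertex-middle : ∀ {j c A B} r → (∀ {k′} → k′ < c + suc r → Expansible k′) →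
      interior Dlam j (c + suc r) ≤ A → countIn Db (suc c + j) r ≤ B →
      Expansion j (c + suc r) 0 (2 ^ A * 3 ^ B) (suc (B + A + 1))
        ((-ᴿ lam (suc c + j)) *ᴿ (S′ c *ᴿ Pm′ (suc (suc c) + j) r))
    vertex-middle zero _ _ _ = empty (trans (*-congˡ (zeroʳ _)) (zeroʳ _))
    vertex-middle {j} {c} {A} {B} (suc r) smaller hA hB =
      relax z≤n ℕ.≤-refl ℕ.≤-refl refl (prepend-λ c suffix (smaller (shorter suffix) _ A B hA′ hB′))
      where
      suffix : suc (suc c) + r ≡ c + suc (suc r)
      suffix = ≡.sym (≡.trans (ℕ.+-suc c (suc r)) (≡.cong suc (ℕ.+-suc c r)))
      hA′ : interior Dlam (suc (suc c) + j) r ≤ A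
      hA′ = ℕ.≤-trans (interior-suffix Dlam (suc (suc c)) j suffix) hA
      hB′ : countIn Db (suc (suc c) + j) r ≤ B
      hB′ = ℕ.≤-trans (countIn-suffix Db 1 (suc c + j) {r} ≡.refl) hB

    vertex-last : ∀ {j r M F} c → Expansion (suc c + j) r 1 M F (P′ (suc c + j) r) →
      Expansion j (c + suc r) 0 M (suc F) ((-ᴿ lam (c + j)) *ᴿ (Sm c *ᴿ P′ (suc c + j) r))
    vertex-last zero _ = empty (trans (*-congˡ (zeroˡ _)) (zeroʳ _))
    vertex-last {r = r} (suc c) e =
      relax z≤n ℕ.≤-refl ℕ.≤-refl refl (prepend-λ c (≡.sym (ℕ.+-suc (suc c) r)) e)

    vertex : ∀ {j c r A B} → (∀ {k′} → k′ < c + suc r → Expansible k′) → Undecorated j c →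
      Db (c + j) ≡ true → interior Dlam j (c + suc r) ≤ A → countIn Db j (c + suc r) ≤ B →
      Expansion j (c + suc r) 1 (2 ^ A * 3 ^ B) (B + A + 1) (P′ j (c + suc r))
    vertex {j} {c} {r} {A} smaller u db hA hB with ℕ.≤-trans (countIn-decorated Db c j r db) hB
    ... | s≤s {n = B′} hB′ =
      relax ℕ.≤-refl (ℕ.≤-reflexive (thrice (2 ^ A) (3 ^ B′))) ℕ.≤-refl cut
        (attachᴱ (plus (xbA (c + j))) (xbOk db (ℕ.m≤n+m j c) (offset<end j suffix) ∷ []) c suffix tail
         ∪ vertex-middle r smaller hA hB′
         ∪ vertex-last c tail)
      where
      suffix : suc c + r ≡ c + suc r
      suffix = ≡.sym (ℕ.+-suc c r)
      tail = smaller (shorter suffix) (suc c + j) A _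
        (ℕ.≤-trans (interior-suffix Dlam (suc c) j suffix) hA) hB′
      Q₁ = P′ (suc c + j) r
      Q₂ = Pm′ (suc (suc c) + j) r
      cut : P′ j (c + suc r) ≈ (x -ᴿ b (c + j)) *ᴿ (S′ c *ᴿ Q₁)
              +ᴿ ((-ᴿ lam (suc c + j)) *ᴿ (S′ c *ᴿ Q₂) +ᴿ (-ᴿ lam (c + j)) *ᴿ (Sm c *ᴿ Q₁))
      cut = begin
        P′ j (c + suc r)
          ≈⟨ P-vertex-cut j c r ⟩
        (x -ᴿ b (c + j)) *ᴿ (P′ j c *ᴿ Q₁) -ᴿ lam (suc c + j) *ᴿ (P′ j c *ᴿ Q₂)
          -ᴿ lam (c + j) *ᴿ (Pm′ j c *ᴿ Q₁)
          ≈⟨ -‿cong₂ (-‿cong₂ (*-congˡ (*-congʳ P≈)) (*-congˡ (*-congʳ P≈))) (*-congˡ (*-congʳ Pm≈)) ⟩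
        (x -ᴿ b (c + j)) *ᴿ (S′ c *ᴿ Q₁) -ᴿ lam (suc c + j) *ᴿ (S′ c *ᴿ Q₂) -ᴿ lam (c + j) *ᴿ (Sm c *ᴿ Q₁)
          ≈⟨ +-assoc _ _ _ ⟩
        _ ≈⟨ +-congˡ (+-cong (-‿distribˡ-* _ _) (-‿distribˡ-* _ _)) ⟩
        _ ∎
        where
        Pm≈ = proj₁ (P-undecorated u)
        P≈ = proj₂ (P-undecorated u)

    edge : ∀ {j c r A B} → (∀ {k′} → k′ < suc c + suc r → Expansible k′) → Undecorated j (suc c) →
      Dlam (suc c + j) ≡ true → interior Dlam j (suc c + suc r) ≤ A → countIn Db j (suc c + suc r) ≤ B →
      Expansion j (suc c + suc r) 1 (2 ^ A * 3 ^ B) (B + A + 1) (P′ j (suc c + suc r))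
    edge {j} {c} {r} {B = B} smaller u dl hA hB with ℕ.≤-trans (interior-decorated Dlam c j r dl) hA
    ... | s≤s {n = A′} hA′ =
      relax (s≤s z≤n) (ℕ.≤-reflexive (twice (2 ^ A′) (3 ^ B))) (ℕ.≤-reflexive (suc-inside B A′)) cut
        (attachᴱ unit [] (suc c) ≡.refl head ∪ prepend-λ c suffix tail)
      where
      suffix : suc (suc c) + r ≡ suc c + suc r
      suffix = ≡.sym (ℕ.+-suc (suc c) r)
      head = smaller (shorter ≡.refl) (suc c + j) _ B hA′
        (ℕ.≤-trans (countIn-suffix Db (suc c) j {suc r} ≡.refl) hB)
      tail = smaller (shorter suffix) (suc (suc c) + j) _ B
        (ℕ.≤-trans (interior-suffix Dlam 1 (suc c + j) {r} ≡.refl) hA′)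
        (ℕ.≤-trans (countIn-suffix Db (suc (suc c)) j suffix) hB)
      cut : P′ j (suc c + suc r) ≈ 1# *ᴿ (S′ (suc c) *ᴿ P′ (suc c + j) (suc r))
              +ᴿ (-ᴿ lam (suc c + j)) *ᴿ (S′ c *ᴿ P′ (suc (suc c) + j) r)
      cut = trans (P-cut j (suc c) (suc r))
        (+-cong (trans (*-congʳ (proj₂ (P-undecorated u))) (sym (*-identityˡ _)))
                (trans (-‿cong (*-congˡ (*-congʳ (proj₁ (P-undecorated u))))) (-‿distribˡ-* _ _)))

    expand : ∀ k → Expansible k
    expand = <-rec Expansible step
      where
      step : ∀ k → (∀ {k′} → k′ < k → Expansible k′) → Expansible k
      step k smaller j A B hA hB with firstDecoration j k
      ... | none u = background {A = A} {B} u
      ... | at-b c r u db = vertex smaller u db hA hB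
      ... | at-λ c r u dl = edge smaller u dl hA hB

    -- S_0 = 1, so padding with index 0 does not change the product.
    padded : ∀ {n} → List ℕ → Fin n → ℕ
    padded [] i = 0
    padded (k ∷ ks) Fin.zero = k
    padded (k ∷ ks) (Fin.suc i) = padded ks i

    prodF-padded : ∀ F ks → length ks ≤ F → prodF F (λ i → S′ (padded ks i)) ≈ ∏S ks
    prodF-padded zero [] _ = refl
    prodF-padded (suc F) [] _ = trans (*-identityˡ _) (prodF-padded F [] z≤n)
    prodF-padded (suc F) (k ∷ ks) (s≤s h) = *-congˡ (prodF-padded F ks h)

    sumTerms-sumF : ∀ F ts → All (λ t → length (factors t) ≤ F) ts →
      sumTerms ts ≈ sumF (length ts) (λ m → coefVal b lam x (negative (lookup ts m)) (atoms (lookup ts m))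
                                              *ᴿ prodF F (λ i → S′ (padded (factors (lookup ts m)) i)))
    sumTerms-sumF F [] [] = refl
    sumTerms-sumF F (t ∷ ts) (h ∷ hs) =
      +-cong (*-congˡ (sym (prodF-padded F (factors t) h))) (sumTerms-sumF F ts hs)

    decomposition : ∀ j k →
      ∃[ mmax ] ∃[ imax ]
        (1 ≤ mmax × mmax ≤ 2 ^ countIn Dlam j k * 3 ^ countIn Db j k
         × 1 ≤ imax × imax ≤ countIn Db j k + countIn Dlam j k + 1
         × Σ (Fin mmax → Fin imax → ℕ) (λ kk →
           Σ (Fin mmax → Bool) (λ sgn →
           Σ (Fin mmax → List Atom) (λ atoms →
             (∀ m → All (Admissible Db j k) (atoms m))
             × (P′ j k ≈ sumF mmax (λ m →
                  coefVal b lam x (sgn m) (atoms m) *ᴿ prodF imax (λ i → S′ (kk m i))))))))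
    decomposition j k =
      length ts , _ , #terms≥ e , #terms≤ e , ℕ.m≤n+m 1 _ , ℕ.≤-refl ,
      (λ m → padded (factors (lookup ts m))) , (λ m → negative (lookup ts m)) , (λ m → atoms (lookup ts m)) ,
      (λ m → All.lookup (admissible e) (∈-lookup m)) , trans (value e) (sumTerms-sumF _ ts (#factors≤ e))
      where
      e = expand k j (countIn Dlam j k) (countIn Db j k) (interior≤countIn Dlam j k) ℕ.≤-refl
      ts = terms e

theorem3 : ∀ {c ℓ : Level} (R : CommutativeRing c ℓ) →
  let open Poly R in
  (∀ (b lam : ℕ → Carrier) → (∀ i → 1 ≤ i → ¬ (lam i ≈ 0#)) →
    ∀ (x : Carrier) (j k c : ℕ) → 2 ≤ k → 1 ≤ c → c ≤ k ∸ 1 →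
      (P b lam x j k ≈ P b lam x j c *ᴿ P b lam x (j + c) (k ∸ c)
          -ᴿ lam (c + j) *ᴿ (P b lam x j (c ∸ 1) *ᴿ P b lam x (j + c + 1) (k ∸ c ∸ 1)))
      × (P b lam x j k ≈ (x -ᴿ b (c + j)) *ᴿ (P b lam x j c *ᴿ P b lam x (j + c + 1) (k ∸ c ∸ 1))
          -ᴿ lam (j + c + 1) *ᴿ (P b lam x j c *ᴿ Pm b lam x (j + c + 2) (k ∸ c ∸ 1))
          -ᴿ lam (c + j) *ᴿ (P b lam x j (c ∸ 1) *ᴿ P b lam x (j + c + 1) (k ∸ c ∸ 1))))
  ×
  (∀ (b lam : ℕ → Carrier) → (∀ i → 1 ≤ i → ¬ (lam i ≈ 0#)) →
    ∀ (b₀ lam₀ : Carrier) → ¬ (lam₀ ≈ 0#) →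
    ∀ (Db Dlam : ℕ → Bool) (bh lamh : ℕ → Carrier) →
    (∀ i → Db i ≡ false → b i ≈ b₀) →
    (∀ i → Db i ≡ true → b i ≈ b₀ +ᴿ bh i) →
    (∀ i → 1 ≤ i → Dlam i ≡ false → lam i ≈ lam₀) →
    (∀ i → 1 ≤ i → Dlam i ≡ true → lam i ≈ lam₀ +ᴿ lamh i) →
    ∀ (x : Carrier) (j k : ℕ) →
    ∃[ mmax ] ∃[ imax ]
      (1 ≤ mmax × mmax ≤ 2 ^ countIn Dlam j k * 3 ^ countIn Db j k
       × 1 ≤ imax × imax ≤ countIn Db j k + countIn Dlam j k + 1
       × Σ (Fin mmax → Fin imax → ℕ) (\ kk →
         Σ (Fin mmax → Bool) (\ sgn →
         Σ (Fin mmax → List Atom) (\ atoms →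
           (∀ m → All (Admissible Db j k) (atoms m))
           × (P b lam x j k ≈ sumF mmax (\ m →
                coefVal b lam x (sgn m) (atoms m)
                *ᴿ prodF imax (\ i → S b₀ lam₀ x (kk m i)))))))))
-- Neither λ_i ≠ 0 nor the values of the decorations are needed: the coefficients a_m are
-- products of the actual weights λ_i and x - b_i.
theorem3 R =
  (λ b lam _ x → Recurrence.cut-identities b lam x) ,
  (λ b lam _ b₀ lam₀ _ Db Dlam _ _ b-background _ lam-background _ x →
     decomposition b lam b₀ lam₀ Db Dlam x b-background lam-background)
  where
  open Cutting R
  open Decomposition R
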